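{- Let $e,t$ be positive integers and let $q=r^t=2^{et}$, where $r=2^e$. Let $k<t$ be a positive integer such that $\gcd(k,t)\neq 1$ in the case $e=1$. Pick $\alpha\in\mathbb{F}_q\setminus(\mathbb{F}_q)^{r^k-1}$, where $(\mathbb{F}_q)^{r^k-1}=\{y^{r^k-1}: y\in\mathbb{F}_q\}$. Then $\alpha x^{1+(r^k-1)(q+1)q/2}$ is a complete permutation polynomial of $\mathbb{F}_{q^2}$.
   Context: A polynomial $f(x)\in\mathbb{F}_Q[x]$ is a permutation polynomial of $\mathbb{F}_Q$ if the map $\alpha\mapsto f(\alpha)$ is a bijection of $\mathbb{F}_Q$. It is a complete permutation polynomial of $\mathbb{F}_Q$ if both $f(x)$ and $f(x)+x$ are permutation polynomials of $\mathbb{F}_Q$. -}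

module Defs where

open import Level using (Level)
open import Data.Nat using (ℕ; zero; suc)
open import Data.Fin using (Fin)
open import Data.Product using (Σ; _×_; ∃)
open import Relation.Binary.PropositionalEquality using (_≡_)
open import Relation.Nullary using (¬_)
open import Algebra.Bundles using (CommutativeRing)
open import Function.Definitions using (Injective; Surjective)

module _ {c ℓ : Level} (R : CommutativeRing c ℓ) where
  open CommutativeRing R

  IsField : Set (c Level.⊔ ℓ)
  IsField = (¬ (1# ≈ 0#)) × (∀ x → ¬ (x ≈ 0#) → ∃ λ y → (x * y) ≈ 1#)

  pow : Carrier → ℕ → Carrier
  pow x zero = 1#
  pow x (suc n) = x * pow x n

  HasCardinality : ℕ → Set (c Level.⊔ ℓ)
  HasCardinality N = Σ (Fin N → Carrier) λ enum →
    Injective _≡_ _≈_ enum × (∀ x → ∃ λ i → enum i ≈ x)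

  IsPermutation : (Carrier → Carrier) → Set (c Level.⊔ ℓ)
  IsPermutation f = Injective _≈_ _≈_ f × Surjective _≈_ _≈_ f

  IsCompletePermutation : (Carrier → Carrier) → Set (c Level.⊔ ℓ)
  IsCompletePermutation f = IsPermutation f × IsPermutation (λ x → f x + x)

{-# OPTIONS --safe #-}

-- Let 𝔽_q = {y | y ^ q = y}, s = r ^ k - 1 and ν(x) = x ^ ((q + 1) q / 2), which takes values
-- in 𝔽_q and is the identity there. Then f x = α x ^ D = x μ(x) with μ(x) = α ν(x) ^ s ∈ 𝔽_q, so
-- ν(f x) = α ν(x) ^ (s + 1) and ν(f x + x) = α ν(x) ^ (s + 1) + ν(x). In characteristic 2 the
-- map u ↦ u ^ (s + 1) = u ^ (r ^ k) is additive, so both right-hand sides are injective in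
-- ν(x) ∈ 𝔽_q: a collision u ≠ v in the second would give α (u + v) ^ s = 1, making α the s-th
-- power of (u + v)⁻¹ ∈ 𝔽_q. Thus f x (resp. f x + x) determines ν(x), hence the multiplier,
-- hence x; and an injective map of a finite field is a bijection.
module Submission where

open import Defs
open import Level using (Level)
open import Algebra.Bundles using (CommutativeRing)
import Algebra.Properties.CommutativeSemigroup as CommutativeSemigroupProperties
open import Data.Empty using (⊥-elim)
open import Data.Fin using (Fin; punchIn; punchOut)
import Data.Fin.Properties as Fin
open import Data.Fin.Permutation using (Permutation; permutation)
import Data.Nat as ℕ
open import Data.Nat using (ℕ; zero; suc; NonZero)
import Data.Nat.Properties as ℕₚ
open import Data.Nat.DivMod using (m*n/n≡m)
open import Data.Product using (∃; _,_; proj₁; proj₂)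
open import Function.Base using (_∘_)
open import Function.Definitions using (Injective; Congruent)
open import Relation.Binary.Definitions using (Decidable)
open import Relation.Binary.PropositionalEquality as ≡ using (_≡_; _≢_)
open import Relation.Nullary using (¬_; yes; no)
open import Relation.Nullary.Negation using (contradiction)

injective⇒surjective : ∀ {n} (f : Fin n → Fin n) → Injective _≡_ _≡_ f → ∀ j → ∃ λ i → f i ≡ j
injective⇒surjective {zero} f _ ()
injective⇒surjective {suc n} f f-injective j with Fin.any? (λ i → f i Fin.≟ j)
... | yes hit = hit
... | no miss = contradiction (Fin.injective⇒≤ punchedOut-injective) ℕₚ.1+n≰n
  where
  punchedOut : Fin (suc n) → Fin n
  punchedOut i = punchOut {i = j} (miss ∘ (i ,_) ∘ ≡.sym)
  punchedOut-injective : Injective _≡_ _≡_ punchedOut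
  punchedOut-injective = f-injective ∘ Fin.punchOut-injective {i = j} _ _

injective⇒permutation : ∀ {n} (f : Fin n → Fin n) → Injective _≡_ _≡_ f → Permutation n n
injective⇒permutation f f-injective =
  permutation f (proj₁ ∘ surjective) (proj₂ ∘ surjective) (λ i → f-injective (proj₂ (surjective (f i))))
  where
  surjective : ∀ j → ∃ λ i → f i ≡ j
  surjective = injective⇒surjective f f-injective

m*[2*n]/2≡m*n : ∀ m n → m ℕ.* (2 ℕ.* n) ℕ./ 2 ≡ m ℕ.* n
m*[2*n]/2≡m*n m n = ≡.trans (≡.cong (ℕ._/ 2) m*[2*n]≡m*n*2) (m*n/n≡m (m ℕ.* n) 2)
  where
  m*[2*n]≡m*n*2 : m ℕ.* (2 ℕ.* n) ≡ m ℕ.* n ℕ.* 2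
  m*[2*n]≡m*n*2 = ≡.trans (≡.cong (m ℕ.*_) (ℕₚ.*-comm 2 n)) (≡.sym (ℕₚ.*-assoc m n 2))

2^n≡2*2^[n∸1] : ∀ {n} → 1 ℕ.≤ n → 2 ℕ.^ n ≡ 2 ℕ.* 2 ℕ.^ (n ℕ.∸ 1)
2^n≡2*2^[n∸1] {suc n} _ = ≡.refl

1+[[2^e]^k∸1]≡2^[e*k] : ∀ e k → suc ((2 ℕ.^ e) ℕ.^ k ℕ.∸ 1) ≡ 2 ℕ.^ (e ℕ.* k)
1+[[2^e]^k∸1]≡2^[e*k] e k rewrite ℕₚ.^-*-assoc 2 e k = ℕₚ.m+[n∸m]≡n (ℕₚ.m^n>0 2 (e ℕ.* k))

[2^e]^k∸1≢0 : ∀ {e k} → 1 ℕ.≤ e → 1 ℕ.≤ k → NonZero ((2 ℕ.^ e) ℕ.^ k ℕ.∸ 1)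
[2^e]^k∸1≢0 {e} {k} e≥1 k≥1 rewrite ℕₚ.^-*-assoc 2 e k =
  ℕ.>-nonZero (ℕₚ.∸-monoˡ-≤ 1 (ℕₚ.^-monoʳ-≤ 2 (ℕₚ.*-mono-≤ e≥1 k≥1)))

module Powers {c ℓ} (R : CommutativeRing c ℓ) where
  open CommutativeRing R
  open import Algebra.Properties.CommutativeSemiring.Exp commutativeSemiring public
  open import Algebra.Properties.Ring ring using (-1*x≈-x; -‿involutive)

  pow≡^ : ∀ x n → pow R x n ≡ x ^ n
  pow≡^ x zero = ≡.refl
  pow≡^ x (suc n) = ≡.cong (x *_) (pow≡^ x n)

  pow-congˡ : ∀ {x y} n → x ≈ y → pow R x n ≈ pow R y n
  pow-congˡ zero _ = refl
  pow-congˡ (suc n) x≈y = *-cong x≈y (pow-congˡ n x≈y)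

  1^n≈1 : ∀ n → 1# ^ n ≈ 1#
  1^n≈1 zero = refl
  1^n≈1 (suc n) = trans (*-identityˡ _) (1^n≈1 n)

  0^n≈0 : ∀ n .{{_ : NonZero n}} → 0# ^ n ≈ 0#
  0^n≈0 (suc n) = zeroˡ _

  x^2≈x*x : ∀ x → x ^ 2 ≈ x * x
  x^2≈x*x x = *-congˡ (*-identityʳ x)

  ^-swap : ∀ x m n → (x ^ m) ^ n ≈ (x ^ n) ^ m
  ^-swap x m n = trans (^-assocʳ x m n) (trans (^-congʳ x (ℕₚ.*-comm m n)) (sym (^-assocʳ x n m)))

  AdditivePower : ℕ → Set (c Level.⊔ ℓ)
  AdditivePower n = ∀ x y → (x + y) ^ n ≈ x ^ n + y ^ n

  x^[2n]≈x⇒x+x≈0 : ∀ n → (∀ x → x ^ (2 ℕ.* n) ≈ x) → ∀ x → x + x ≈ 0#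
  x^[2n]≈x⇒x+x≈0 n x^[2n]≈x x = begin
    x + x        ≈⟨ +-congˡ -x≈x ⟨
    x + - x      ≈⟨ -‿inverseʳ x ⟩
    0#           ∎
    where
    open import Relation.Binary.Reasoning.Setoid setoid
    -1≈1 : - 1# ≈ 1#
    -1≈1 = begin
      - 1#               ≈⟨ x^[2n]≈x (- 1#) ⟨
      (- 1#) ^ (2 ℕ.* n) ≈⟨ ^-assocʳ (- 1#) 2 n ⟨
      ((- 1#) ^ 2) ^ n   ≈⟨ ^-congˡ n (trans (x^2≈x*x (- 1#)) (-1*x≈-x (- 1#))) ⟩
      (- - 1#) ^ n       ≈⟨ ^-congˡ n (-‿involutive 1#) ⟩
      1# ^ n             ≈⟨ 1^n≈1 n ⟩
      1#                 ∎
    -x≈x : - x ≈ x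
    -x≈x = trans (sym (-1*x≈-x x)) (trans (*-congʳ -1≈1) (*-identityˡ x))

module _ {c ℓ} (R : CommutativeRing c ℓ) where
  open CommutativeRing R
  open Powers R
  open import Relation.Binary.Reasoning.Setoid setoid

  module Characteristic2 (x+x≈0 : ∀ x → x + x ≈ 0#) where

    x+y≈0⇒x≈y : ∀ {x y} → x + y ≈ 0# → x ≈ y
    x+y≈0⇒x≈y {x} {y} x+y≈0 = begin
      x            ≈⟨ +-identityʳ x ⟨
      x + 0#       ≈⟨ +-congˡ (x+x≈0 y) ⟨
      x + (y + y)  ≈⟨ +-assoc x y y ⟨
      (x + y) + y  ≈⟨ +-congʳ x+y≈0 ⟩
      0# + y       ≈⟨ +-identityˡ y ⟩
      y            ∎

    [x+y]*[x+y]≈x*x+y*y : ∀ x y → (x + y) * (x + y) ≈ x * x + y * y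
    [x+y]*[x+y]≈x*x+y*y x y = begin
      (x + y) * (x + y)                  ≈⟨ distribʳ (x + y) x y ⟩
      x * (x + y) + y * (x + y)          ≈⟨ +-cong (distribˡ x x y) (distribˡ y x y) ⟩
      (x * x + x * y) + (y * x + y * y)  ≈⟨ +-congˡ (+-comm (y * x) (y * y)) ⟩
      (x * x + x * y) + (y * y + y * x)  ≈⟨ interchange (x * x) (x * y) (y * y) (y * x) ⟩
      (x * x + y * y) + (x * y + y * x)  ≈⟨ +-congˡ (trans (+-congˡ (*-comm y x)) (x+x≈0 (x * y))) ⟩
      (x * x + y * y) + 0#               ≈⟨ +-identityʳ _ ⟩
      x * x + y * y                      ∎
      where open CommutativeSemigroupProperties +-commutativeSemigroup using (interchange)

    ^2-additive : AdditivePower 2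
    ^2-additive x y = begin
      (x + y) ^ 2        ≈⟨ x^2≈x*x (x + y) ⟩
      (x + y) * (x + y)  ≈⟨ [x+y]*[x+y]≈x*x+y*y x y ⟩
      x * x + y * y      ≈⟨ +-cong (x^2≈x*x x) (x^2≈x*x y) ⟨
      x ^ 2 + y ^ 2      ∎

    frobenius : ∀ n → AdditivePower (2 ℕ.^ n)
    frobenius zero x y = trans (*-identityʳ _) (sym (+-cong (*-identityʳ x) (*-identityʳ y)))
    frobenius (suc n) x y = begin
      (x + y) ^ (2 ℕ.* 2 ℕ.^ n)               ≈⟨ ^-assocʳ (x + y) 2 (2 ℕ.^ n) ⟨
      ((x + y) ^ 2) ^ 2 ℕ.^ n                 ≈⟨ ^-congˡ (2 ℕ.^ n) (^2-additive x y) ⟩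
      (x ^ 2 + y ^ 2) ^ 2 ℕ.^ n               ≈⟨ frobenius n (x ^ 2) (y ^ 2) ⟩
      (x ^ 2) ^ 2 ℕ.^ n + (y ^ 2) ^ 2 ℕ.^ n   ≈⟨ +-cong (^-assocʳ x 2 (2 ℕ.^ n)) (^-assocʳ y 2 (2 ℕ.^ n)) ⟩
      x ^ (2 ℕ.* 2 ℕ.^ n) + y ^ (2 ℕ.* 2 ℕ.^ n) ∎

module Field {c ℓ} (F : CommutativeRing c ℓ) (isField : IsField F) where
  open CommutativeRing F
  open Powers F

  1≉0 : ¬ 1# ≈ 0#
  1≉0 = proj₁ isField

  inverse : ∀ {x} → ¬ x ≈ 0# → ∃ λ y → x * y ≈ 1#
  inverse = proj₂ isField _

  *-cancelʳ : ∀ {x y z} → ¬ z ≈ 0# → x * z ≈ y * z → x ≈ y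
  *-cancelʳ {x} {y} {z} z≉0 xz≈yz = begin
    x              ≈⟨ *-identityʳ x ⟨
    x * 1#         ≈⟨ *-congˡ z*z⁻¹≈1 ⟨
    x * (z * z⁻¹)  ≈⟨ *-assoc x z z⁻¹ ⟨
    (x * z) * z⁻¹  ≈⟨ *-congʳ xz≈yz ⟩
    (y * z) * z⁻¹  ≈⟨ *-assoc y z z⁻¹ ⟩
    y * (z * z⁻¹)  ≈⟨ *-congˡ z*z⁻¹≈1 ⟩
    y * 1#         ≈⟨ *-identityʳ y ⟩
    y              ∎
    where
    open import Relation.Binary.Reasoning.Setoid setoid
    z⁻¹ : Carrier
    z⁻¹ = proj₁ (inverse z≉0)
    z*z⁻¹≈1 : z * z⁻¹ ≈ 1#
    z*z⁻¹≈1 = proj₂ (inverse z≉0)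

  *-cancelˡ : ∀ {x y z} → ¬ z ≈ 0# → z * x ≈ z * y → x ≈ y
  *-cancelˡ {x} {y} {z} z≉0 zx≈zy = *-cancelʳ z≉0 (trans (*-comm x z) (trans zx≈zy (*-comm z y)))

  x*y≈0⇒y≈0 : ∀ {x y} → ¬ x ≈ 0# → x * y ≈ 0# → y ≈ 0#
  x*y≈0⇒y≈0 {x} {y} x≉0 xy≈0 = *-cancelˡ x≉0 (trans xy≈0 (sym (zeroʳ x)))

  *-≉0 : ∀ {x y} → ¬ x ≈ 0# → ¬ y ≈ 0# → ¬ x * y ≈ 0#
  *-≉0 x≉0 y≉0 = y≉0 ∘ x*y≈0⇒y≈0 x≉0

  ^-≉0 : ∀ {x} n → ¬ x ≈ 0# → ¬ x ^ n ≈ 0#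
  ^-≉0 zero x≉0 = 1≉0
  ^-≉0 (suc n) x≉0 = *-≉0 x≉0 (^-≉0 n x≉0)

module DecidableField {c ℓ} (F : CommutativeRing c ℓ) (isField : IsField F)
  (_≈?_ : Decidable (CommutativeRing._≈_ F)) where
  open CommutativeRing F
  open Powers F
  open Field F isField

  x^n≈0⇒x≈0 : ∀ {x} n → x ^ n ≈ 0# → x ≈ 0#
  x^n≈0⇒x≈0 {x} n x^n≈0 with x ≈? 0#
  ... | yes x≈0 = x≈0
  ... | no x≉0 = contradiction x^n≈0 (^-≉0 n x≉0)

  scaling-injective : (ν μ : Carrier → Carrier) → Congruent _≈_ _≈_ ν →
    (∀ {x y} → ν x ≈ ν y → μ x ≈ μ y) →
    (∀ {x y} → ν (x * μ x) ≈ ν (y * μ y) → ν x ≈ ν y) →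
    (∀ {x} → μ x ≈ 0# → x ≈ 0#) →
    Injective _≈_ _≈_ (λ x → x * μ x)
  scaling-injective ν μ ν-cong μ-factors ν-detects μ≈0⇒x≈0 {x} {y} xμx≈yμy
    with μ x ≈? 0# | μ-factors (ν-detects (ν-cong xμx≈yμy))
  ... | yes μx≈0 | μx≈μy = trans (μ≈0⇒x≈0 μx≈0) (sym (μ≈0⇒x≈0 (trans (sym μx≈μy) μx≈0)))
  ... | no μx≉0  | μx≈μy = *-cancelʳ μx≉0 (trans xμx≈yμy (*-congˡ (sym μx≈μy)))

module FiniteField {c ℓ} (F : CommutativeRing c ℓ) {N : ℕ} (card : HasCardinality F N) where
  open CommutativeRing F

  enum : Fin N → Carrier
  enum = proj₁ card

  enum-injective : Injective _≡_ _≈_ enum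
  enum-injective = proj₁ (proj₂ card)

  index : Carrier → Fin N
  index x = proj₁ (proj₂ (proj₂ card) x)

  enum-index : ∀ x → enum (index x) ≈ x
  enum-index x = proj₂ (proj₂ (proj₂ card) x)

  index-injective : ∀ {x y} → index x ≡ index y → x ≈ y
  index-injective {x} {y} eq = trans (sym (enum-index x)) (trans (reflexive (≡.cong enum eq)) (enum-index y))

  index-cong : ∀ {x y} → x ≈ y → index x ≡ index y
  index-cong {x} {y} x≈y = enum-injective (trans (enum-index x) (trans x≈y (sym (enum-index y))))

  _≈?_ : Decidable _≈_
  x ≈? y with index x Fin.≟ index y
  ... | yes eq = yes (index-injective eq)
  ... | no neq = no (neq ∘ index-cong)

  injective⇒isPermutation : ∀ {f} → Congruent _≈_ _≈_ f → Injective _≈_ _≈_ f → IsPermutation F f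
  injective⇒isPermutation {f} f-cong f-injective = f-injective , surjective
    where
    f̂ : Fin N → Fin N
    f̂ i = index (f (enum i))
    f̂-injective : Injective _≡_ _≡_ f̂
    f̂-injective = enum-injective ∘ f-injective ∘ index-injective
    surjective : ∀ y → ∃ λ x → ∀ {z} → z ≈ x → f z ≈ y
    surjective y = let (i , f̂i≡y) = injective⇒surjective f̂ f̂-injective (index y) in
      enum i , λ z≈enum-i → trans (f-cong z≈enum-i) (index-injective f̂i≡y)

module Fermat {c ℓ} (F : CommutativeRing c ℓ) (isField : IsField F) where
  open CommutativeRing F
  open Powers F
  open Field F isField
  open import Algebra.Properties.CommutativeMonoid.Sum *-commutativeMonoid
    using (sum-cong-≋; sum-replicate; ∑-distrib-+; sum-permute) renaming (sum to ∏)
  open import Relation.Binary.Reasoning.Setoid setoid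

  ∏-≉0 : ∀ {n} (f : Fin n → Carrier) → (∀ i → ¬ f i ≈ 0#) → ¬ ∏ f ≈ 0#
  ∏-≉0 {zero} f _ = 1≉0
  ∏-≉0 {suc n} f f≉0 = *-≉0 (f≉0 Fin.zero) (∏-≉0 (f ∘ Fin.suc) (f≉0 ∘ Fin.suc))

  module _ {M : ℕ} (card : HasCardinality F (suc M)) where
    open FiniteField F card

    nonzero : Fin M → Carrier
    nonzero i = enum (punchIn (index 0#) i)

    nonzero≉0 : ∀ i → ¬ nonzero i ≈ 0#
    nonzero≉0 i nonzero-i≈0 = Fin.punchInᵢ≢i (index 0#) i (enum-injective (trans nonzero-i≈0 (sym (enum-index 0#))))

    module _ {x : Carrier} (x≉0 : ¬ x ≈ 0#) where
      index-0≢index-x*nonzero : ∀ i → index 0# ≢ index (x * nonzero i)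
      index-0≢index-x*nonzero i = *-≉0 x≉0 (nonzero≉0 i) ∘ sym ∘ index-injective

      multiply : Fin M → Fin M
      multiply i = punchOut (index-0≢index-x*nonzero i)

      nonzero-multiply : ∀ i → nonzero (multiply i) ≈ x * nonzero i
      nonzero-multiply i = trans (reflexive (≡.cong enum (Fin.punchIn-punchOut (index-0≢index-x*nonzero i)))) (enum-index _)

      multiply-injective : Injective _≡_ _≡_ multiply
      multiply-injective {i} {j} eq = Fin.punchIn-injective (index 0#) i j (enum-injective (*-cancelˡ x≉0 (begin
        x * nonzero i         ≈⟨ nonzero-multiply i ⟨
        nonzero (multiply i)  ≡⟨ ≡.cong nonzero eq ⟩
        nonzero (multiply j)  ≈⟨ nonzero-multiply j ⟩
        x * nonzero j         ∎)))

      ∏nonzero≈x^M*∏nonzero : ∏ nonzero ≈ x ^ M * ∏ nonzero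
      ∏nonzero≈x^M*∏nonzero = begin
        ∏ nonzero                              ≈⟨ sum-permute nonzero (injective⇒permutation multiply multiply-injective) ⟩
        ∏ (nonzero ∘ multiply)                 ≈⟨ sum-cong-≋ nonzero-multiply ⟩
        ∏ (λ i → x * nonzero i)                ≈⟨ ∑-distrib-+ (λ _ → x) nonzero ⟩
        ∏ (λ (_ : Fin M) → x) * ∏ nonzero      ≈⟨ *-congʳ (sum-replicate M) ⟩
        x ^ M * ∏ nonzero                      ∎

    x^[1+M]≈x : ∀ x → x ^ suc M ≈ x
    x^[1+M]≈x x with x ≈? 0#
    ... | yes x≈0 = trans (^-congˡ (suc M) x≈0) (trans (0^n≈0 (suc M)) (sym x≈0))
    ... | no x≉0 = begin
      x * x ^ M   ≈⟨ *-congˡ x^M≈1 ⟩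
      x * 1#      ≈⟨ *-identityʳ x ⟩
      x           ∎
      where
      x^M≈1 : x ^ M ≈ 1#
      x^M≈1 = sym (*-cancelʳ (∏-≉0 nonzero nonzero≉0) (trans (*-identityˡ _) (∏nonzero≈x^M*∏nonzero x≉0)))

  x^N≈x : ∀ {N} → HasCardinality F N → ∀ x → x ^ N ≈ x
  x^N≈x {zero} card x = contradiction (FiniteField.index F card x) λ ()
  x^N≈x {suc M} card = x^[1+M]≈x card

module _ {c ℓ} (F : CommutativeRing c ℓ) (isField : IsField F)
  (_≈?_ : Decidable (CommutativeRing._≈_ F)) where
  open CommutativeRing F
  open Powers F
  open Field F isField
  open DecidableField F isField _≈?_
  open CommutativeSemigroupProperties *-commutativeSemigroup using (x∙yz≈y∙xz)
  open CommutativeSemigroupProperties +-commutativeSemigroup using (interchange)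
  open import Relation.Binary.Reasoning.Setoid setoid

  module CompleteMonomial (q m : ℕ) (q≡2^[1+m] : q ≡ 2 ℕ.^ suc m) (x^q²≈x : ∀ x → x ^ (q ℕ.* q) ≈ x)
           (s n : ℕ) .{{_ : NonZero s}} (1+s≡2^n : suc s ≡ 2 ℕ.^ n)
           (α : Carrier) (α-fixed : pow F α q ≈ α) (α-nonpower : ∀ y → pow F y q ≈ y → ¬ pow F y s ≈ α) where

    p : ℕ
    p = 2 ℕ.^ m

    x+x≈0 : ∀ x → x + x ≈ 0#
    x+x≈0 = x^[2n]≈x⇒x+x≈0 (p ℕ.* q) (λ x → trans (^-congʳ x 2*[p*q]≡q*q) (x^q²≈x x))
      where
      2*[p*q]≡q*q : 2 ℕ.* (p ℕ.* q) ≡ q ℕ.* q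
      2*[p*q]≡q*q = ≡.trans (≡.sym (ℕₚ.*-assoc 2 p q)) (≡.cong (ℕ._* q) (≡.sym q≡2^[1+m]))

    open Characteristic2 F x+x≈0 using (x+y≈0⇒x≈y; frobenius)

    ^q-additive : AdditivePower q
    ^q-additive = ≡.subst AdditivePower (≡.sym q≡2^[1+m]) (frobenius (suc m))

    ^[1+s]-additive : AdditivePower (suc s)
    ^[1+s]-additive = ≡.subst AdditivePower (≡.sym 1+s≡2^n) (frobenius n)

    Fixed : Carrier → Set ℓ
    Fixed y = y ^ q ≈ y

    fixed-resp : ∀ {x y} → x ≈ y → Fixed x → Fixed y
    fixed-resp x≈y x-fixed = trans (^-congˡ q (sym x≈y)) (trans x-fixed x≈y)

    fixed-α : Fixed α
    fixed-α = ≡.subst (_≈ α) (pow≡^ α q) α-fixed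

    α≉fixed^s : ∀ {y} → Fixed y → ¬ y ^ s ≈ α
    α≉fixed^s {y} y-fixed = α-nonpower y (≡.subst (_≈ y) (≡.sym (pow≡^ y q)) y-fixed) ∘ ≡.subst (_≈ α) (≡.sym (pow≡^ y s))

    fixed-0 : Fixed 0#
    fixed-0 = begin
      0# ^ q            ≈⟨ ^-congˡ q (+-identityʳ 0#) ⟨
      (0# + 0#) ^ q     ≈⟨ ^q-additive 0# 0# ⟩
      0# ^ q + 0# ^ q   ≈⟨ x+x≈0 (0# ^ q) ⟩
      0#                ∎

    fixed-1 : Fixed 1#
    fixed-1 = 1^n≈1 q

    fixed-+ : ∀ {x y} → Fixed x → Fixed y → Fixed (x + y)
    fixed-+ {x} {y} x-fixed y-fixed = trans (^q-additive x y) (+-cong x-fixed y-fixed)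

    fixed-* : ∀ {x y} → Fixed x → Fixed y → Fixed (x * y)
    fixed-* {x} {y} x-fixed y-fixed = trans (^-distrib-* x y q) (*-cong x-fixed y-fixed)

    fixed-^ : ∀ {x} n → Fixed x → Fixed (x ^ n)
    fixed-^ {x} n x-fixed = trans (^-swap x n q) (^-congˡ n x-fixed)

    fixed-inverse : ∀ {x y} → x * y ≈ 1# → Fixed x → Fixed y
    fixed-inverse {x} {y} x*y≈1 x-fixed = *-cancelʳ x≉0 (begin
      y ^ q * x      ≈⟨ *-congˡ x-fixed ⟨
      y ^ q * x ^ q  ≈⟨ ^-distrib-* y x q ⟨
      (y * x) ^ q    ≈⟨ ^-congˡ q y*x≈1 ⟩
      1# ^ q         ≈⟨ fixed-1 ⟩
      1#             ≈⟨ y*x≈1 ⟨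
      y * x          ∎)
      where
      y*x≈1 : y * x ≈ 1#
      y*x≈1 = trans (*-comm y x) x*y≈1
      x≉0 : ¬ x ≈ 0#
      x≉0 x≈0 = 1≉0 (trans (sym x*y≈1) (trans (*-congʳ x≈0) (zeroˡ y)))

    x^[q+1]≈x^q*x : ∀ x → x ^ (q ℕ.+ 1) ≈ x ^ q * x
    x^[q+1]≈x^q*x x = trans (^-homo-* x q 1) (*-congˡ (*-identityʳ x))

    norm-fixed : ∀ x → Fixed (x ^ (q ℕ.+ 1))
    norm-fixed x = begin
      (x ^ (q ℕ.+ 1)) ^ q      ≈⟨ ^-congˡ q (x^[q+1]≈x^q*x x) ⟩
      (x ^ q * x) ^ q          ≈⟨ ^-distrib-* (x ^ q) x q ⟩
      (x ^ q) ^ q * x ^ q      ≈⟨ *-congʳ (trans (^-assocʳ x q q) (x^q²≈x x)) ⟩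
      x * x ^ q                ≈⟨ *-comm x (x ^ q) ⟩
      x ^ q * x                ≈⟨ x^[q+1]≈x^q*x x ⟨
      x ^ (q ℕ.+ 1)            ∎

    h : ℕ
    h = (q ℕ.+ 1) ℕ.* p

    -- x ^ h = x ^ ((q + 1) q / 2) is the square root, in the subfield 𝔽_q, of the norm x ^ (q + 1)
    normRoot : Carrier → Carrier
    normRoot x = x ^ h

    normRoot-fixed : ∀ x → Fixed (normRoot x)
    normRoot-fixed x = fixed-resp (^-assocʳ x (q ℕ.+ 1) p) (fixed-^ p (norm-fixed x))

    normRoot-on-fixed : ∀ {x} → Fixed x → normRoot x ≈ x
    normRoot-on-fixed {x} x-fixed = begin
      x ^ h                  ≈⟨ ^-assocʳ x (q ℕ.+ 1) p ⟨
      (x ^ (q ℕ.+ 1)) ^ p    ≈⟨ ^-congˡ p (trans (x^[q+1]≈x^q*x x) (*-congʳ x-fixed)) ⟩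
      (x * x) ^ p            ≈⟨ ^-congˡ p (x^2≈x*x x) ⟨
      (x ^ 2) ^ p            ≈⟨ ^-assocʳ x 2 p ⟩
      x ^ (2 ℕ.* p)          ≈⟨ ^-congʳ x q≡2^[1+m] ⟨
      x ^ q                  ≈⟨ x-fixed ⟩
      x                      ∎

    normRoot-*-fixed : ∀ x {c} → Fixed c → normRoot (x * c) ≈ normRoot x * c
    normRoot-*-fixed x {c} c-fixed = trans (^-distrib-* x c h) (*-congˡ (normRoot-on-fixed c-fixed))

    μ : Carrier → Carrier
    μ x = α * normRoot x ^ s

    μ-fixed : ∀ x → Fixed (μ x)
    μ-fixed x = fixed-* fixed-α (fixed-^ s (normRoot-fixed x))

    μ-factors : ∀ {x y} → normRoot x ≈ normRoot y → μ x ≈ μ y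
    μ-factors = *-congˡ ∘ ^-congˡ s

    α*u^[1+s]≈u*[α*u^s] : ∀ u → α * u ^ suc s ≈ u * (α * u ^ s)
    α*u^[1+s]≈u*[α*u^s] u = x∙yz≈y∙xz α u (u ^ s)

    normRoot-x*μx : ∀ x → normRoot (x * μ x) ≈ α * normRoot x ^ suc s
    normRoot-x*μx x = trans (normRoot-*-fixed x (μ-fixed x)) (sym (α*u^[1+s]≈u*[α*u^s] (normRoot x)))

    normRoot-x*[μx+1] : ∀ x → normRoot (x * (μ x + 1#)) ≈ α * normRoot x ^ suc s + normRoot x
    normRoot-x*[μx+1] x = begin
      normRoot (x * (μ x + 1#))                    ≈⟨ normRoot-*-fixed x (fixed-+ (μ-fixed x) fixed-1) ⟩
      normRoot x * (μ x + 1#)                      ≈⟨ distribˡ (normRoot x) (μ x) 1# ⟩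
      normRoot x * μ x + normRoot x * 1#           ≈⟨ +-cong (sym (α*u^[1+s]≈u*[α*u^s] (normRoot x))) (*-identityʳ (normRoot x)) ⟩
      α * normRoot x ^ suc s + normRoot x          ∎

    α≉0 : ¬ α ≈ 0#
    α≉0 α≈0 = α≉fixed^s fixed-0 (trans (0^n≈0 s) (sym α≈0))

    α*w^s≉1 : ∀ {w} → Fixed w → ¬ α * w ^ s ≈ 1#
    α*w^s≉1 {w} w-fixed α*w^s≈1 with w ≈? 0#
    ... | yes w≈0 = 1≉0 (trans (sym α*w^s≈1) (trans (*-congˡ (trans (^-congˡ s w≈0) (0^n≈0 s))) (zeroʳ α)))
    ... | no w≉0 = α≉fixed^s (fixed-inverse w*w⁻¹≈1 w-fixed) (begin
      w⁻¹ ^ s                 ≈⟨ *-identityˡ _ ⟨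
      1# * w⁻¹ ^ s            ≈⟨ *-congʳ α*w^s≈1 ⟨
      α * w ^ s * w⁻¹ ^ s     ≈⟨ *-assoc α (w ^ s) (w⁻¹ ^ s) ⟩
      α * (w ^ s * w⁻¹ ^ s)   ≈⟨ *-congˡ (^-distrib-* w w⁻¹ s) ⟨
      α * (w * w⁻¹) ^ s       ≈⟨ *-congˡ (trans (^-congˡ s w*w⁻¹≈1) (1^n≈1 s)) ⟩
      α * 1#                  ≈⟨ *-identityʳ α ⟩
      α                       ∎)
      where
      w⁻¹ : Carrier
      w⁻¹ = proj₁ (inverse w≉0)
      w*w⁻¹≈1 : w * w⁻¹ ≈ 1#
      w*w⁻¹≈1 = proj₂ (inverse w≉0)

    ^[1+s]-injective : ∀ {u v} → u ^ suc s ≈ v ^ suc s → u ≈ v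
    ^[1+s]-injective {u} {v} u^R≈v^R = x+y≈0⇒x≈y (x^n≈0⇒x≈0 (suc s) (begin
      (u + v) ^ suc s              ≈⟨ ^[1+s]-additive u v ⟩
      u ^ suc s + v ^ suc s        ≈⟨ +-congʳ u^R≈v^R ⟩
      v ^ suc s + v ^ suc s        ≈⟨ x+x≈0 _ ⟩
      0#                           ∎))

    α*u^[1+s]+u-injective : ∀ {u v} → Fixed u → Fixed v → α * u ^ suc s + u ≈ α * v ^ suc s + v → u ≈ v
    α*u^[1+s]+u-injective {u} {v} u-fixed v-fixed eq with (u + v) ≈? 0#
    ... | yes u+v≈0 = x+y≈0⇒x≈y u+v≈0
    ... | no u+v≉0 = contradiction (*-cancelˡ u+v≉0 (x+y≈0⇒x≈y (begin
      (u + v) * (α * (u + v) ^ s) + (u + v) * 1#          ≈⟨ +-cong (α*u^[1+s]≈u*[α*u^s] (u + v)) (sym (*-identityʳ (u + v))) ⟨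
      α * (u + v) ^ suc s + (u + v)                        ≈⟨ +-congʳ (*-congˡ (^[1+s]-additive u v)) ⟩
      α * (u ^ suc s + v ^ suc s) + (u + v)                ≈⟨ +-congʳ (distribˡ α _ _) ⟩
      (α * u ^ suc s + α * v ^ suc s) + (u + v)            ≈⟨ interchange _ _ u v ⟩
      (α * u ^ suc s + u) + (α * v ^ suc s + v)            ≈⟨ +-congʳ eq ⟩
      (α * v ^ suc s + v) + (α * v ^ suc s + v)            ≈⟨ x+x≈0 _ ⟩
      0#                                                   ∎)))
      (α*w^s≉1 (fixed-+ u-fixed v-fixed))

    D : ℕ
    D = 1 ℕ.+ (s ℕ.* (q ℕ.+ 1) ℕ.* q) ℕ./ 2

    D≡1+s*h : D ≡ suc (s ℕ.* h)
    D≡1+s*h = ≡.cong suc (≡.trans (≡.cong (λ j → s ℕ.* (q ℕ.+ 1) ℕ.* j ℕ./ 2) q≡2^[1+m])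
      (≡.trans (m*[2*n]/2≡m*n (s ℕ.* (q ℕ.+ 1)) p) (ℕₚ.*-assoc s (q ℕ.+ 1) p)))

    f : Carrier → Carrier
    f x = α * pow F x D

    f≈x*μx : ∀ x → f x ≈ x * μ x
    f≈x*μx x = begin
      α * pow F x D             ≡⟨ ≡.cong (α *_) (pow≡^ x D) ⟩
      α * x ^ D                 ≈⟨ *-congˡ (^-congʳ x D≡1+s*h) ⟩
      α * (x * x ^ (s ℕ.* h))   ≈⟨ *-congˡ (*-congˡ x^[s*h]≈normRoot[x]^s) ⟩
      α * (x * normRoot x ^ s)  ≈⟨ x∙yz≈y∙xz α x (normRoot x ^ s) ⟩
      x * μ x                   ∎
      where
      x^[s*h]≈normRoot[x]^s : x ^ (s ℕ.* h) ≈ normRoot x ^ s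
      x^[s*h]≈normRoot[x]^s = trans (^-congʳ x (ℕₚ.*-comm s h)) (sym (^-assocʳ x h s))

    f-cong : Congruent _≈_ _≈_ f
    f-cong = *-congˡ ∘ pow-congˡ D

    f-injective : Injective _≈_ _≈_ f
    f-injective {x} {y} fx≈fy =
      scaling-injective normRoot μ (^-congˡ h) μ-factors normRoot-detects μx≈0⇒x≈0
        (trans (sym (f≈x*μx x)) (trans fx≈fy (f≈x*μx y)))
      where
      normRoot-detects : ∀ {x y} → normRoot (x * μ x) ≈ normRoot (y * μ y) → normRoot x ≈ normRoot y
      normRoot-detects {x} {y} eq =
        ^[1+s]-injective (*-cancelˡ α≉0 (trans (sym (normRoot-x*μx x)) (trans eq (normRoot-x*μx y))))
      μx≈0⇒x≈0 : ∀ {x} → μ x ≈ 0# → x ≈ 0#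
      μx≈0⇒x≈0 μx≈0 = x^n≈0⇒x≈0 h (x^n≈0⇒x≈0 s (x*y≈0⇒y≈0 α≉0 μx≈0))

    f+id-injective : Injective _≈_ _≈_ (λ x → f x + x)
    f+id-injective {x} {y} fx+x≈fy+y =
      scaling-injective normRoot (λ x → μ x + 1#) (^-congˡ h) (+-congʳ ∘ μ-factors) normRoot-detects μx+1≈0⇒x≈0
        (trans (sym (f+id≈x*[μx+1] x)) (trans fx+x≈fy+y (f+id≈x*[μx+1] y)))
      where
      f+id≈x*[μx+1] : ∀ x → f x + x ≈ x * (μ x + 1#)
      f+id≈x*[μx+1] x = trans (+-cong (f≈x*μx x) (sym (*-identityʳ x))) (sym (distribˡ x (μ x) 1#))
      normRoot-detects : ∀ {x y} → normRoot (x * (μ x + 1#)) ≈ normRoot (y * (μ y + 1#)) → normRoot x ≈ normRoot y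
      normRoot-detects {x} {y} eq = α*u^[1+s]+u-injective (normRoot-fixed x) (normRoot-fixed y)
        (trans (sym (normRoot-x*[μx+1] x)) (trans eq (normRoot-x*[μx+1] y)))
      μx+1≈0⇒x≈0 : ∀ {x} → μ x + 1# ≈ 0# → x ≈ 0#
      μx+1≈0⇒x≈0 {x} μx+1≈0 = ⊥-elim (α*w^s≉1 (normRoot-fixed x) (x+y≈0⇒x≈y μx+1≈0))

open import Data.Nat using (_+_; _*_; _∸_; _^_; _/_; _<_; _≤_)
open import Data.Nat.GCD using (gcd)

corollary2 : {c ℓ : Level} (e t k : ℕ) → 1 ≤ e → 1 ≤ t → 1 ≤ k → k < t →
    (e ≡ 1 → gcd k t ≢ 1) →
    (F : CommutativeRing c ℓ) → IsField F → HasCardinality F ((2 ^ (e * t)) ^ 2) →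
    let r = 2 ^ e
        q = 2 ^ (e * t)
    in (α : CommutativeRing.Carrier F) → CommutativeRing._≈_ F (pow F α q) α →
       (∀ y → CommutativeRing._≈_ F (pow F y q) y → ¬ CommutativeRing._≈_ F (pow F y (r ^ k ∸ 1)) α) →
       IsCompletePermutation F (λ x → CommutativeRing._*_ F α (pow F x (1 + ((r ^ k ∸ 1) * (q + 1) * q) / 2)))
-- k < t and the gcd condition only guarantee that some α as assumed exists.
corollary2 e t k e≥1 t≥1 k≥1 _ _ F isField card α α-fixed α-nonpower =
  injective⇒isPermutation f-cong f-injective ,
  injective⇒isPermutation (λ x≈y → +-cong (f-cong x≈y) x≈y) f+id-injective
  where
  open CommutativeRing F using (_≈_; trans; +-cong)
  open Powers F using (^-congʳ) renaming (_^_ to _^ᶠ_)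
  open FiniteField F card using (_≈?_; injective⇒isPermutation)
  q : ℕ
  q = 2 ^ (e * t)
  x^q²≈x : ∀ x → x ^ᶠ (q * q) ≈ x
  x^q²≈x x = trans (^-congʳ x (≡.cong (q *_) (≡.sym (ℕₚ.*-identityʳ q)))) (Fermat.x^N≈x F isField card x)
  instance
    s≢0 : NonZero ((2 ^ e) ^ k ∸ 1)
    s≢0 = [2^e]^k∸1≢0 e≥1 k≥1
  open CompleteMonomial F isField _≈?_ q (e * t ∸ 1) (2^n≡2*2^[n∸1] (ℕₚ.*-mono-≤ e≥1 t≥1)) x^q²≈x
    ((2 ^ e) ^ k ∸ 1) (e * k) (1+[[2^e]^k∸1]≡2^[e*k] e k) α α-fixed α-nonpower
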